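{- If $\pi$ is a proof of $\vdash\Gamma$ (in linear logic with exponentials), then $\pi^*$ is a seed of $\Gamma$.
   Context: An interface $X$ is a pair $(|X|,P_X)$ with $P_X$ a monotonic predicate transformer on $\mathcal{P}(|X|)$; a seed is $x\subseteq|X|$ with $x\subseteq P_X(x)$. $\overline{x}$ is complement. Dual $X^\perp=(|X|,x\mapsto\overline{P_X(\overline{x})})$; tensor $X\otimes Y$ on $|X|\times|Y|$ with $r\mapsto\bigcup_{x\times y\subseteq r}P_X(x)\times P_Y(y)$; with $X\&Y$ on $|X|+|Y|$ with $(x,y)\mapsto(P_X(x),P_Y(y))$; par $X\mathbin{\text{⅋}}Y=(X^\perp\otimes Y^\perp)^\perp$; $X\oplus Y=(X^\perp\&Y^\perp)^\perp$; units $\mathbf{0}=(\emptyset,\mathrm{Id})$, $\top=\mathbf{0}^\perp$, $\mathbf{1}=(\{*\},\mathrm{Id})$, $\bot=\mathbf{1}^\perp$. For sets of finite multisets, $x\cdot y=\{[a,b]\mid a\in x,b\in y\}$ with indexed version $\prod_i x_i$, and $+$ is multiset union. Exponentials: $!X=(\mathcal{M}_{\mathrm{fin}}(|X|),!P_X)$ where $[a_1,\dots,a_n]\in !P_X(U)$ iff there are $x_1,\dots,x_n$ with $\prod_i x_i\subseteq U$ and $a_i\in P_X(x_i)$ for all $i$; $?X=(!(X^\perp))^\perp$. A sequent $A_1,\dots,A_n$ is interpreted as $A_1\mathbin{\text{⅋}}\cdots\mathbin{\text{⅋}}A_n$. Proofs are interpreted as in the multiplicative-additive case (units, par, tensor,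 plus, with, cut as relational constructions), plus: dereliction $\{(\gamma,[a])\mid(\gamma,a)\in\pi_1^*\}$; weakening $\{(\gamma,[\,])\mid\gamma\in\pi_1^*\}$; contraction $\{(\gamma,l+l')\mid(\gamma,l,l')\in\pi_1^*\}$; promotion from $\pi_1\vdash ?\Gamma,A$ to $\vdash ?\Gamma,!A$: $(\gamma_1,\dots,\gamma_l,[a_1,\dots,a_n])\in\pi^*$ iff each $\gamma_j=\sum_{i=1}^n\gamma_j^i$ with $(\gamma_1^i,\dots,\gamma_l^i,a_i)\in\pi_1^*$ for every $i$. -}

module Defs where

open import Data.Bool using (Bool; true; false; not; _∧_; T)
open import Data.Nat using (ℕ)
open import Data.Unit using () renaming (⊤ to Unit; tt to *)
open import Data.Empty using () renaming (⊥ to Empty)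
open import Data.Product using (Σ; _×_; _,_; proj₁; proj₂)
open import Data.Sum using (_⊎_; inj₁; inj₂)
import Data.Sum as Sum
open import Data.List using (List; []; _∷_; _++_; map; concat)
open import Data.List.Relation.Binary.Pointwise using (Pointwise)
open import Data.List.Relation.Binary.Permutation.Propositional
  using (_↭_; refl; prep; swap; trans)
open import Relation.Binary.PropositionalEquality using (_≡_)
open import Relation.Nullary using (¬_)

-- The paper works in classical set theory.  Subsets of a set A are
-- represented as characteristic functions A → Bool; to form subsets
-- defined by arbitrary (e.g. existential) conditions we use a
-- "classical truth value" oracle ω : Set → Bool, with
--   T (ω P)  ⇔  ¬ ¬ P .
-- Such an oracle exists classically; the theorem takes it as a
-- hypothesis.

record Classical : Set₁ where
  field
    ω       : Set → Bool
    ω-intro : {P : Set} → P → T (ω P)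
    ω-elim  : {P : Set} → T (ω P) → ¬ ¬ P

Subset : Set → Set
Subset A = A → Bool

infix 4 _⊆_
_⊆_ : {A : Set} → Subset A → Subset A → Set
x ⊆ y = ∀ a → T (x a) → T (y a)

∁ : {A : Set} → Subset A → Subset A
∁ x a = not (x a)

record Interface : Set₁ where
  constructor mkI
  field
    web : Set
    P   : Subset web → Subset web
open Interface public

Monotone : Interface → Set
Monotone X = ∀ x y → x ⊆ y → P X x ⊆ P X y

Seed : (X : Interface) → Subset (web X) → Set
Seed X x = x ⊆ P X x

infixr 8 _⊗_ _⅋_
infixr 7 _⊕_ _&_
infix 9 !_ ¿_

data Formula : Set where
  var var⊥ : ℕ → Formula
  𝟎 ⊤ᶠ 𝟏 ⊥ᶠ : Formula
  _⊗_ _⅋_ _⊕_ _&_ : Formula → Formula → Formula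
  !_ ¿_ : Formula → Formula

dual : Formula → Formula
dual (var n)  = var⊥ n
dual (var⊥ n) = var n
dual 𝟎        = ⊤ᶠ
dual ⊤ᶠ       = 𝟎
dual 𝟏        = ⊥ᶠ
dual ⊥ᶠ       = 𝟏
dual (A ⊗ B)  = dual A ⅋ dual B
dual (A ⅋ B)  = dual A ⊗ dual B
dual (A ⊕ B)  = dual A & dual B
dual (A & B)  = dual A ⊕ dual B
dual (! A)    = ¿ dual A
dual (¿ A)    = ! dual A

infix 2 ⊢_
data ⊢_ : List Formula → Set where
  ax    : ∀ {A} → ⊢ dual A ∷ A ∷ []
  cut   : ∀ {A Γ Δ} → ⊢ A ∷ Γ → ⊢ dual A ∷ Δ → ⊢ Γ ++ Δ
  ex    : ∀ {Γ Δ} → Γ ↭ Δ → ⊢ Γ → ⊢ Δ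
  one   : ⊢ 𝟏 ∷ []
  bot   : ∀ {Γ} → ⊢ Γ → ⊢ ⊥ᶠ ∷ Γ
  top   : ∀ {Γ} → ⊢ ⊤ᶠ ∷ Γ
  tens  : ∀ {A B Γ Δ} → ⊢ A ∷ Γ → ⊢ B ∷ Δ → ⊢ A ⊗ B ∷ Γ ++ Δ
  par   : ∀ {A B Γ} → ⊢ A ∷ B ∷ Γ → ⊢ A ⅋ B ∷ Γ
  plus₁ : ∀ {A B Γ} → ⊢ A ∷ Γ → ⊢ A ⊕ B ∷ Γ
  plus₂ : ∀ {A B Γ} → ⊢ B ∷ Γ → ⊢ A ⊕ B ∷ Γ
  with' : ∀ {A B Γ} → ⊢ A ∷ Γ → ⊢ B ∷ Γ → ⊢ A & B ∷ Γ
  der   : ∀ {A Γ} → ⊢ A ∷ Γ → ⊢ ¿ A ∷ Γ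
  weak  : ∀ {A Γ} → ⊢ Γ → ⊢ ¿ A ∷ Γ
  contr : ∀ {A Γ} → ⊢ ¿ A ∷ ¿ A ∷ Γ → ⊢ ¿ A ∷ Γ
  prom  : ∀ {A Γ} → ⊢ A ∷ map ¿_ Γ → ⊢ ! A ∷ map ¿_ Γ

module Sem (C : Classical) where
  open Classical C

  _ᗮ : Interface → Interface
  X ᗮ = mkI (web X) (λ x → ∁ (P X (∁ x)))

  𝟎I : Interface
  𝟎I = mkI Empty (λ x → x)

  𝟏I : Interface
  𝟏I = mkI Unit (λ x → x)

  _⊗I_ : Interface → Interface → Interface
  X ⊗I Y = mkI (web X × web Y) λ r ab →
    ω (Σ (Subset (web X)) λ x → Σ (Subset (web Y)) λ y →
         (∀ a b → T (x a) → T (y b) → T (r (a , b)))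
       × T (P X x (proj₁ ab)) × T (P Y y (proj₂ ab)))

  _&I_ : Interface → Interface → Interface
  X &I Y = mkI (web X ⊎ web Y) λ where
    xy (inj₁ a) → P X (λ a' → xy (inj₁ a')) a
    xy (inj₂ b) → P Y (λ b' → xy (inj₂ b')) b

  _⅋I_ : Interface → Interface → Interface
  X ⅋I Y = ((X ᗮ) ⊗I (Y ᗮ)) ᗮ

  _⊕I_ : Interface → Interface → Interface
  X ⊕I Y = ((X ᗮ) &I (Y ᗮ)) ᗮ

  -- finite multisets over A are represented by lists over A, a list
  -- standing for the multiset of its entries (lists are identified up
  -- to permutation _↭_ everywhere below).
  -- l ∈ ∏ xs  iff  l is a permutation of some [b₁,…,bₙ] with bᵢ ∈ xᵢ
  ∏ : {A : Set} → List (Subset A) → Subset (List A) → Set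
  ∏ {A} xs U = ∀ (l : List A) → Σ (List A) (λ bs →
                 Pointwise (λ x b → T (x b)) xs bs × (l ↭ bs)) → T (U l)
  -- (∏ xs U  means  ∏ᵢ xᵢ ⊆ U)

  !I : Interface → Interface
  !I X = mkI (List (web X)) λ U as →
    ω (Σ (List (Subset (web X))) λ xs →
         ∏ xs U × Pointwise (λ a x → T (P X x a)) as xs)

  ?I : Interface → Interface
  ?I X = (!I (X ᗮ)) ᗮ

  module _ (ρ : ℕ → Interface) where

    ⟦_⟧ : Formula → Interface
    ⟦ var n ⟧  = ρ n
    ⟦ var⊥ n ⟧ = ρ n ᗮ
    ⟦ 𝟎 ⟧      = 𝟎I
    ⟦ ⊤ᶠ ⟧     = 𝟎I ᗮ
    ⟦ 𝟏 ⟧      = 𝟏I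
    ⟦ ⊥ᶠ ⟧     = 𝟏I ᗮ
    ⟦ A ⊗ B ⟧  = ⟦ A ⟧ ⊗I ⟦ B ⟧
    ⟦ A ⅋ B ⟧  = ⟦ A ⟧ ⅋I ⟦ B ⟧
    ⟦ A ⊕ B ⟧  = ⟦ A ⟧ ⊕I ⟦ B ⟧
    ⟦ A & B ⟧  = ⟦ A ⟧ &I ⟦ B ⟧
    ⟦ ! A ⟧    = !I ⟦ A ⟧
    ⟦ ¿ A ⟧    = ?I ⟦ A ⟧

    ⟦_⟧ˢ : List Formula → Interface
    ⟦ [] ⟧ˢ    = 𝟏I ᗮ
    ⟦ A ∷ Γ ⟧ˢ = ⟦ A ⟧ ⅋I ⟦ Γ ⟧ˢ

    ∣_∣ : Formula → Set
    ∣ A ∣ = web ⟦ A ⟧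

    Elem : List Formula → Set
    Elem Γ = web ⟦ Γ ⟧ˢ

    toDual : (A : Formula) → ∣ A ∣ → ∣ dual A ∣
    toDual (var n)  a = a
    toDual (var⊥ n) a = a
    toDual 𝟎        a = a
    toDual ⊤ᶠ       a = a
    toDual 𝟏        a = a
    toDual ⊥ᶠ       a = a
    toDual (A ⊗ B) (a , b) = toDual A a , toDual B b
    toDual (A ⅋ B) (a , b) = toDual A a , toDual B b
    toDual (A ⊕ B) ab = Sum.map (toDual A) (toDual B) ab
    toDual (A & B) ab = Sum.map (toDual A) (toDual B) ab
    toDual (! A) l = map (toDual A) l
    toDual (¿ A) l = map (toDual A) l

    Eq : (A : Formula) → ∣ A ∣ → ∣ A ∣ → Set
    Eq (var n)  a a' = a ≡ a'
    Eq (var⊥ n) a a' = a ≡ a'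
    Eq 𝟎        a a' = a ≡ a'
    Eq ⊤ᶠ       a a' = a ≡ a'
    Eq 𝟏        a a' = a ≡ a'
    Eq ⊥ᶠ       a a' = a ≡ a'
    Eq (A ⊗ B) (a , b) (a' , b') = Eq A a a' × Eq B b b'
    Eq (A ⅋ B) (a , b) (a' , b') = Eq A a a' × Eq B b b'
    Eq (A ⊕ B) (inj₁ a) (inj₁ a') = Eq A a a'
    Eq (A ⊕ B) (inj₂ b) (inj₂ b') = Eq B b b'
    Eq (A ⊕ B) _ _ = Empty
    Eq (A & B) (inj₁ a) (inj₁ a') = Eq A a a'
    Eq (A & B) (inj₂ b) (inj₂ b') = Eq B b b'
    Eq (A & B) _ _ = Empty
    Eq (! A) l l' = Σ (List ∣ A ∣) λ m → (l ↭ m) × Pointwise (Eq A) m l'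
    Eq (¿ A) l l' = Σ (List ∣ A ∣) λ m → (l ↭ m) × Pointwise (Eq A) m l'

    split : (Γ : List Formula) {Δ : List Formula} →
            Elem (Γ ++ Δ) → Elem Γ × Elem Δ
    split [] e = * , e
    split (A ∷ Γ) (a , e) with split Γ e
    ... | γ , δ = (a , γ) , δ

    -- transport along an exchange (from the new to the old order)
    permElem : {Γ Δ : List Formula} → Γ ↭ Δ → Elem Δ → Elem Γ
    permElem refl e = e
    permElem (prep x p) (a , e) = a , permElem p e
    permElem (swap x y p) (b , a , e) = a , b , permElem p e
    permElem (trans p q) e = permElem p (permElem q e)

    sumᵉ : (Γ : List Formula) → List (Elem (map ¿_ Γ)) → Elem (map ¿_ Γ)
    sumᵉ [] gs = *
    sumᵉ (A ∷ Γ) gs =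
      concat (map proj₁ gs) , sumᵉ Γ (map proj₂ gs)

    PermEq : (Γ : List Formula) → Elem (map ¿_ Γ) → Elem (map ¿_ Γ) → Set
    PermEq [] _ _ = Unit
    PermEq (A ∷ Γ) (l , γ) (l' , γ') = (l ↭ l') × PermEq Γ γ γ'

    ⟦_⟧ᵖ : {Γ : List Formula} → ⊢ Γ → Subset (Elem Γ)
    ⟦ ax {A} ⟧ᵖ (b , a , _) = ω (Eq (dual A) b (toDual A a))
    ⟦ cut {A} {Γ} π₁ π₂ ⟧ᵖ e with split Γ e
    ... | γ , δ = ω (Σ ∣ A ∣ λ a →
                      T (⟦ π₁ ⟧ᵖ (a , γ)) × T (⟦ π₂ ⟧ᵖ (toDual A a , δ)))
    ⟦ ex p π₁ ⟧ᵖ e = ⟦ π₁ ⟧ᵖ (permElem p e)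
    ⟦ one ⟧ᵖ _ = true
    ⟦ bot π₁ ⟧ᵖ (_ , γ) = ⟦ π₁ ⟧ᵖ γ
    ⟦ top ⟧ᵖ _ = false
    ⟦ tens {Γ = Γ} π₁ π₂ ⟧ᵖ ((a , b) , e) with split Γ e
    ... | γ , δ = ⟦ π₁ ⟧ᵖ (a , γ) ∧ ⟦ π₂ ⟧ᵖ (b , δ)
    ⟦ par π₁ ⟧ᵖ ((a , b) , γ) = ⟦ π₁ ⟧ᵖ (a , b , γ)
    ⟦ plus₁ π₁ ⟧ᵖ (inj₁ a , γ) = ⟦ π₁ ⟧ᵖ (a , γ)
    ⟦ plus₁ π₁ ⟧ᵖ (inj₂ b , γ) = false
    ⟦ plus₂ π₁ ⟧ᵖ (inj₁ a , γ) = false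
    ⟦ plus₂ π₁ ⟧ᵖ (inj₂ b , γ) = ⟦ π₁ ⟧ᵖ (b , γ)
    ⟦ with' π₁ π₂ ⟧ᵖ (inj₁ a , γ) = ⟦ π₁ ⟧ᵖ (a , γ)
    ⟦ with' π₁ π₂ ⟧ᵖ (inj₂ b , γ) = ⟦ π₂ ⟧ᵖ (b , γ)
    ⟦ der π₁ ⟧ᵖ (a ∷ [] , γ) = ⟦ π₁ ⟧ᵖ (a , γ)
    ⟦ der π₁ ⟧ᵖ (_ , γ) = false
    ⟦ weak π₁ ⟧ᵖ ([] , γ) = ⟦ π₁ ⟧ᵖ γ
    ⟦ weak π₁ ⟧ᵖ (_ ∷ _ , γ) = false
    ⟦ contr {A} π₁ ⟧ᵖ (m , γ) =
      ω (Σ (List ∣ A ∣) λ l → Σ (List ∣ A ∣) λ l' →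
           (m ↭ l ++ l') × T (⟦ π₁ ⟧ᵖ (l , l' , γ)))
    ⟦ prom {A} {Γ} π₁ ⟧ᵖ (as , γ) =
      ω (Σ (List (Elem (map ¿_ Γ))) λ gs →
           Pointwise (λ a g → T (⟦ π₁ ⟧ᵖ (a , g))) as gs
         × PermEq Γ γ (sumᵉ Γ gs))

-- A subset r of the web of A₁ ⅋ ⋯ ⅋ Aₙ is a seed as soon as it passes every
-- test: whenever subsets tᵢ ⊆ |Aᵢ| cover r (every point of r has some
-- component in its tᵢ), every point of r has some component aᵢ ∈ P(tᵢ).
-- Each rule preserves this property.  For cut, tensor and promotion the test
-- handed to a premise π on A, Γ is a residual: the points of A that π* links
-- to a point of Γ missing the tests on Γ.  The seed property of the premise
-- puts the active point into P of its residual, and the cover hypothesis of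
-- the conclusion makes the residuals of the two premises complementary (cut,
-- where ⟦ dual A ⟧ is ⟦ A ⟧ᗮ) or a rectangle inside the tensor test.  For a
-- context ?Γ, failure of P at ?B is witnessed by a factorisation, which
-- promotion splits along the sum of contexts and contraction along the
-- splitting of the multiset.

module Submission where

open import Defs
open import Data.Bool using (true; false; not; T; _∧_)
open import Data.Bool.Properties using (T?; T-∧)
open import Data.Empty using (⊥; ⊥-elim)
open import Data.List using (List; []; _∷_; _++_; map; concat)
open import Data.List.Relation.Binary.Pointwise as Pointwise using (Pointwise; []; _∷_)
open import Data.List.Relation.Binary.Permutation.Propositional as ↭
  using (_↭_; ↭-refl; ↭-sym; ↭-trans; prep; swap)
import Data.List.Relation.Binary.Permutation.Propositional.Properties as ↭ₚ
open import Data.Nat using (ℕ)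
open import Data.Product using (∃; ∃₂; _×_; _,_; proj₁; proj₂)
open import Data.Sum using (_⊎_; inj₁; inj₂; [_,_]; map₁; map₂)
open import Data.Unit using (⊤; tt)
open import Function using (_∘_)
open import Function.Bundles using (_⇔_; mk⇔; Equivalence)
open import Relation.Binary.PropositionalEquality using (_≡_; refl; cong; subst; sym)
open import Relation.Nullary using (¬_)
open import Relation.Nullary.Decidable using (decidable-stable)

open Equivalence using (to; from)

T-not⇒¬T : ∀ {b} → T (not b) → ¬ T b
T-not⇒¬T {true} () _

¬T⇒T-not : ∀ {b} → ¬ T b → T (not b)
¬T⇒T-not {true} ¬t = ⊥-elim (¬t _)
¬T⇒T-not {false} _ = _

T-stable : ∀ {b} → ¬ ¬ T b → T b
T-stable {b} = decidable-stable (T? b)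

T-not-not⁺ : ∀ {b} → T b → T (not (not b))
T-not-not⁺ {true} t = t

T-not-not⁻ : ∀ {b} → T (not (not b)) → T b
T-not-not⁻ {true} t = t

⊆∁∁ : {A : Set} {x : Subset A} → x ⊆ ∁ (∁ x)
⊆∁∁ a = T-not-not⁺

∁∁⊆ : {A : Set} {x : Subset A} → ∁ (∁ x) ⊆ x
∁∁⊆ a = T-not-not⁻

∁-anti : {A : Set} {x y : Subset A} → x ⊆ y → ∁ y ⊆ ∁ x
∁-anti x⊆y a h = ¬T⇒T-not (T-not⇒¬T h ∘ x⊆y a)

module _ {A B : Set} {R : A → B → Set} where

  Pointwise-↭ˡ : ∀ {l m xs} → Pointwise R l xs → l ↭ m → ∃ λ ys → Pointwise R m ys × xs ↭ ys
  Pointwise-↭ˡ rs ↭.refl = _ , rs , ↭-refl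
  Pointwise-↭ˡ (r ∷ rs) (prep x p) with Pointwise-↭ˡ rs p
  ... | _ , rs′ , q = _ , r ∷ rs′ , prep _ q
  Pointwise-↭ˡ (r ∷ r′ ∷ rs) (swap x y p) with Pointwise-↭ˡ rs p
  ... | _ , rs′ , q = _ , r′ ∷ r ∷ rs′ , swap _ _ q
  Pointwise-↭ˡ rs (↭.trans p q) with Pointwise-↭ˡ rs p
  ... | _ , rs′ , q₁ with Pointwise-↭ˡ rs′ q
  ... | _ , rs″ , q₂ = _ , rs″ , ↭-trans q₁ q₂

  Pointwise-++ˡ⁻ : ∀ l {l′ ys} → Pointwise R (l ++ l′) ys →
    ∃₂ λ ys₁ ys₂ → ys ≡ ys₁ ++ ys₂ × Pointwise R l ys₁ × Pointwise R l′ ys₂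
  Pointwise-++ˡ⁻ [] rs = [] , _ , refl , [] , rs
  Pointwise-++ˡ⁻ (a ∷ l) (r ∷ rs) with Pointwise-++ˡ⁻ l rs
  ... | ys₁ , ys₂ , refl , rs₁ , rs₂ = _ ∷ ys₁ , ys₂ , refl , r ∷ rs₁ , rs₂

module _ {A A′ B : Set} {R : A′ → B → Set} {f : A → A′} where

  Pointwise-mapˡ⁻ : ∀ {xs ys} → Pointwise R (map f xs) ys → Pointwise (R ∘ f) xs ys
  Pointwise-mapˡ⁻ {[]} [] = []
  Pointwise-mapˡ⁻ {x ∷ xs} (r ∷ rs) = r ∷ Pointwise-mapˡ⁻ rs

  Pointwise-mapˡ⁺ : ∀ {xs ys} → Pointwise (R ∘ f) xs ys → Pointwise R (map f xs) ys
  Pointwise-mapˡ⁺ [] = []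
  Pointwise-mapˡ⁺ (r ∷ rs) = r ∷ Pointwise-mapˡ⁺ rs

Pointwise-mapʳ⁺ : {A B B′ : Set} {R : A → B′ → Set} {f : B → B′} {xs : List A} {ys : List B} →
  Pointwise (λ a b → R a (f b)) xs ys → Pointwise R xs (map f ys)
Pointwise-mapʳ⁺ [] = []
Pointwise-mapʳ⁺ (r ∷ rs) = r ∷ Pointwise-mapʳ⁺ rs

concat⁺-↭ : {A : Set} {xss yss : List (List A)} → xss ↭ yss → concat xss ↭ concat yss
concat⁺-↭ ↭.refl = ↭-refl
concat⁺-↭ (prep xs p) = ↭ₚ.++⁺ˡ xs (concat⁺-↭ p)
concat⁺-↭ (swap xs ys p) = ↭-trans (↭ₚ.shifts xs ys) (↭ₚ.++⁺ˡ ys (↭ₚ.++⁺ˡ xs (concat⁺-↭ p)))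
concat⁺-↭ (↭.trans p q) = ↭-trans (concat⁺-↭ p) (concat⁺-↭ q)

module Soundness (C : Classical) (ρ : ℕ → Interface) (ρ-monotone : ∀ n → Monotone (ρ n)) where
  open Classical C
  open Sem C

  ω-map : {Q R : Set} → (Q → R) → T (ω Q) → T (ω R)
  ω-map f h = T-stable λ ¬r → ω-elim h (¬r ∘ ω-intro ∘ f)

  ¬ω-intro : {Q : Set} → ¬ Q → T (not (ω Q))
  ¬ω-intro ¬q = ¬T⇒T-not λ h → ω-elim h ¬q

  ¬ω-elim : {Q : Set} → T (not (ω Q)) → ¬ Q
  ¬ω-elim h = T-not⇒¬T h ∘ ω-intro

  ⟪_⟫ : Formula → Interface
  ⟪ A ⟫ = ⟦_⟧ ρ A

  ⟪_⟫ˢ : List Formula → Interface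
  ⟪ Γ ⟫ˢ = ⟦_⟧ˢ ρ Γ

  ⟪_⟫ᵖ : {Γ : List Formula} → ⊢ Γ → Subset (Elem ρ Γ)
  ⟪ π ⟫ᵖ = ⟦_⟧ᵖ ρ π

  ∣_∣ᶠ : Formula → Set
  ∣ A ∣ᶠ = ∣_∣ ρ A

  toᗮ : (A : Formula) → ∣ A ∣ᶠ → ∣ dual A ∣ᶠ
  toᗮ = toDual ρ

  ᗮ-monotone : (X : Interface) → Monotone X → Monotone (X ᗮ)
  ᗮ-monotone X mono x y x⊆y a h = ¬T⇒T-not (T-not⇒¬T h ∘ mono (∁ y) (∁ x) (∁-anti x⊆y) a)

  ⊗-monotone : (X Y : Interface) → Monotone (X ⊗I Y)
  ⊗-monotone X Y r s r⊆s ab = ω-map λ { (x , y , x×y⊆r , px , py) →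
    x , y , (λ a b xa yb → r⊆s _ (x×y⊆r a b xa yb)) , px , py }

  &-monotone : (X Y : Interface) → Monotone X → Monotone Y → Monotone (X &I Y)
  &-monotone X Y monoX monoY x y x⊆y (inj₁ a) = monoX _ _ (x⊆y ∘ inj₁) a
  &-monotone X Y monoX monoY x y x⊆y (inj₂ b) = monoY _ _ (x⊆y ∘ inj₂) b

  !-monotone : (X : Interface) → Monotone (!I X)
  !-monotone X U V U⊆V l = ω-map λ { (xs , ∏xs⊆U , pxs) → xs , (λ l′ e → U⊆V l′ (∏xs⊆U l′ e)) , pxs }

  𝟎-monotone : Monotone 𝟎I
  𝟎-monotone x y x⊆y = x⊆y

  𝟏-monotone : Monotone 𝟏I
  𝟏-monotone x y x⊆y = x⊆y

  ⟪⟫-monotone : ∀ A → Monotone ⟪ A ⟫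
  ⟪⟫-monotone (var n) = ρ-monotone n
  ⟪⟫-monotone (var⊥ n) = ᗮ-monotone _ (ρ-monotone n)
  ⟪⟫-monotone 𝟎 = 𝟎-monotone
  ⟪⟫-monotone ⊤ᶠ = ᗮ-monotone _ 𝟎-monotone
  ⟪⟫-monotone 𝟏 = 𝟏-monotone
  ⟪⟫-monotone ⊥ᶠ = ᗮ-monotone _ 𝟏-monotone
  ⟪⟫-monotone (A ⊗ B) = ⊗-monotone ⟪ A ⟫ ⟪ B ⟫
  ⟪⟫-monotone (A ⅋ B) = ᗮ-monotone _ (⊗-monotone _ _)
  ⟪⟫-monotone (A ⊕ B) =
    ᗮ-monotone _ (&-monotone _ _ (ᗮ-monotone _ (⟪⟫-monotone A)) (ᗮ-monotone _ (⟪⟫-monotone B)))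
  ⟪⟫-monotone (A & B) = &-monotone _ _ (⟪⟫-monotone A) (⟪⟫-monotone B)
  ⟪⟫-monotone (! A) = !-monotone _
  ⟪⟫-monotone (¿ A) = ᗮ-monotone _ (!-monotone _)

  ⅋-P-intro : (X Y : Interface) (w : Subset (web X × web Y)) (a : web X) (b : web Y) →
    (∀ x y → (∀ a′ b′ → T (w (a′ , b′)) → ¬ ¬ (T (x a′) ⊎ T (y b′))) →
      ¬ ¬ (T (P X x a) ⊎ T (P Y y b))) →
    T (P (X ⅋I Y) w (a , b))
  ⅋-P-intro X Y w a b H = ¬ω-intro λ { (x , y , x×y⊆∁w , ¬px , ¬py) →
    H (∁ x) (∁ y)
      (λ a′ b′ wab ¬∁ → T-not⇒¬T (x×y⊆∁w a′ b′ (T-stable (¬∁ ∘ inj₁ ∘ ¬T⇒T-not))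
                                               (T-stable (¬∁ ∘ inj₂ ∘ ¬T⇒T-not))) wab)
      [ T-not⇒¬T ¬px , T-not⇒¬T ¬py ] }

  Tests : List Formula → Set
  Tests [] = ⊤
  Tests (A ∷ Γ) = Subset ∣ A ∣ᶠ × Tests Γ

  Somewhere : (∀ A → Subset ∣ A ∣ᶠ → ∣ A ∣ᶠ → Set) → ∀ Γ → Tests Γ → Elem ρ Γ → Set
  Somewhere Q [] _ _ = ⊥
  Somewhere Q (A ∷ Γ) (x , t) (a , e) = Q A x a ⊎ Somewhere Q Γ t e

  Hit : ∀ Γ → Tests Γ → Elem ρ Γ → Set
  Hit = Somewhere λ A x a → T (x a)

  Hitᴾ : ∀ Γ → Tests Γ → Elem ρ Γ → Set
  Hitᴾ = Somewhere λ A x a → T (P ⟪ A ⟫ x a)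

  Covers : ∀ Γ → Tests Γ → Subset (Elem ρ Γ) → Set
  Covers Γ t r = ∀ e → T (r e) → ¬ ¬ Hit Γ t e

  SeedByTests : ∀ Γ → Subset (Elem ρ Γ) → Set
  SeedByTests Γ r = ∀ e → T (r e) → ∀ t → Covers Γ t r → ¬ ¬ Hitᴾ Γ t e

  ⟪⟫ˢ-P-intro : ∀ Γ (w : Subset (Elem ρ Γ)) e → (∀ t → Covers Γ t w → ¬ ¬ Hitᴾ Γ t e) →
    T (P ⟪ Γ ⟫ˢ w e)
  ⟪⟫ˢ-P-intro [] w e H = T-stable λ ¬p → H tt (λ _ we _ → ¬p (T-not-not⁺ we)) λ ()
  ⟪⟫ˢ-P-intro (A ∷ Γ) w (a , γ) H = ⅋-P-intro ⟪ A ⟫ ⟪ Γ ⟫ˢ w a γ λ x y cov ¬p →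
    ¬p (inj₂ (⟪⟫ˢ-P-intro Γ y γ λ t cov′ ¬hit →
      H (x , t)
        (λ { (a′ , γ′) wa ¬hit′ →
             cov a′ γ′ wa [ ¬hit′ ∘ inj₁ , (λ yγ → cov′ γ′ yγ (¬hit′ ∘ inj₂)) ] })
        [ ¬p ∘ inj₁ , ¬hit ]))

  seed-by-tests : ∀ Γ (r : Subset (Elem ρ Γ)) → SeedByTests Γ r → Seed ⟪ Γ ⟫ˢ r
  seed-by-tests Γ r r-seed e re = ⟪⟫ˢ-P-intro Γ r e (r-seed e re)

  _∈ᴾ_ : {A : Set} → List A → List (Subset A) → Set
  bs ∈ᴾ xs = Pointwise (λ x b → T (x b)) xs bs

  ∏-resp-↭ : {A : Set} {xs xs′ : List (Subset A)} {U : Subset (List A)} → ∏ xs U → xs ↭ xs′ → ∏ xs′ U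
  ∏-resp-↭ ∏xs⊆U xs↭xs′ l (bs , bs∈ , l↭bs) with Pointwise-↭ˡ bs∈ (↭-sym xs↭xs′)
  ... | bs′ , bs′∈ , bs↭bs′ = ∏xs⊆U l (bs′ , bs′∈ , ↭-trans l↭bs bs↭bs′)

  image : {A B : Set} → (A → B) → Subset A → Subset B
  image f x b = ω (∃ λ a → f a ≡ b × T (x a))

  ⊆image : {A B : Set} (f : A → B) {x : Subset A} → x ⊆ image f x ∘ f
  ⊆image f a xa = ω-intro (a , refl , xa)

  image-×⊆ : {A A′ B B′ : Set} (f : A → A′) (g : B → B′) {u : Subset A} {v : Subset B}
    (r : Subset (A′ × B′)) → (∀ a b → T (u a) → T (v b) → T (r (f a , g b))) →
    ∀ a′ b′ → T (image f u a′) → T (image g v b′) → T (r (a′ , b′))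
  image-×⊆ f g r u×v⊆ a′ b′ ia ib = T-stable λ ¬r →
    ω-elim ia λ { (a , refl , ua) → ω-elim ib λ { (b , refl , vb) → ¬r (u×v⊆ a b ua vb) } }

  Pointwise-image⁻ : {A B : Set} (f : A → B) {ys : List (Subset A)} {bs : List B} →
    Pointwise (λ y b → T (image f y b)) ys bs → ¬ ¬ (∃ λ as → as ∈ᴾ ys × map f as ≡ bs)
  Pointwise-image⁻ f [] k = k ([] , [] , refl)
  Pointwise-image⁻ f (ib ∷ ibs) k = ω-elim ib λ { (a , refl , ya) →
    Pointwise-image⁻ f ibs λ { (as , as∈ , refl) → k (a ∷ as , ya ∷ as∈ , refl) } }

  ∏-image : {A B : Set} (f : A → B) (ys : List (Subset A)) (U : Subset (List B)) →
    ∏ ys (U ∘ map f) → ∏ (map (image f) ys) U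
  ∏-image f ys U ∏ys⊆ l (bs , bs∈ , l↭bs) = T-stable λ ¬Ul →
    Pointwise-image⁻ f (Pointwise-mapˡ⁻ bs∈) λ { (as , as∈ , fas≡bs) →
      let (l₀ , l≡fl₀ , as↭l₀) = ↭ₚ.↭-map-inv f (↭-sym (subst (l ↭_) (sym fas≡bs) l↭bs))
      in ¬Ul (subst (T ∘ U) (sym l≡fl₀) (∏ys⊆ l₀ (as , as∈ , ↭-sym as↭l₀))) }

  ∏-preimage : {A B : Set} (f : A → B) (xs : List (Subset B)) (U : Subset (List B)) →
    ∏ xs U → ∏ (map (_∘ f) xs) (U ∘ map f)
  ∏-preimage f xs U ∏xs⊆U l (bs , bs∈ , l↭bs) =
    ∏xs⊆U (map f l) (map f bs , Pointwise-mapʳ⁺ (Pointwise-mapˡ⁻ bs∈) , ↭ₚ.map⁺ f l↭bs)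

  ᗮ-P⇔ : (X : Interface) → ∀ x a → T (P (X ᗮ) x a) ⇔ (¬ T (P X (∁ x) a))
  ᗮ-P⇔ X x a = mk⇔ T-not⇒¬T ¬T⇒T-not

  ᗮᗮ-P⇔ : (X : Interface) → Monotone X → ∀ x a → T (P X x a) ⇔ (¬ T (P (X ᗮ) (∁ x) a))
  ᗮᗮ-P⇔ X mono x a = mk⇔
    (λ p h → T-not⇒¬T h (mono _ _ ⊆∁∁ a p))
    (λ ¬h → T-stable λ ¬p → ¬h (¬T⇒T-not λ q → ¬p (mono _ _ ∁∁⊆ a q)))

  Duality : Formula → Set
  Duality A = ∀ (x : Subset ∣ dual A ∣ᶠ) a →
    T (P ⟪ dual A ⟫ x (toᗮ A a)) ⇔ (¬ T (P ⟪ A ⟫ (∁ (x ∘ toᗮ A)) a))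

  module Transfer (A : Formula) (DA : Duality A) where

    mono : Monotone ⟪ A ⟫
    mono = ⟪⟫-monotone A

    image⁺ : ∀ {u a} → T (P ⟪ A ⟫ u a) → T (P (⟪ dual A ⟫ ᗮ) (image (toᗮ A) u) (toᗮ A a))
    image⁺ {a = a} pu = ¬T⇒T-not λ p →
      to (DA _ a) p (mono _ _ (λ a′ ua′ → T-not-not⁺ (⊆image (toᗮ A) a′ ua′)) a pu)

    imageᗮ⁺ : ∀ {u a} → T (P (⟪ A ⟫ ᗮ) u a) → T (P ⟪ dual A ⟫ (image (toᗮ A) u) (toᗮ A a))
    imageᗮ⁺ {a = a} pu = from (DA _ a) λ p → T-not⇒¬T pu (mono _ _ (∁-anti (⊆image (toᗮ A))) a p)

    preimage⁺ : ∀ {u a} → T (P (⟪ dual A ⟫ ᗮ) u (toᗮ A a)) → T (P ⟪ A ⟫ (u ∘ toᗮ A) a)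
    preimage⁺ {u} {a} pu = T-stable λ ¬q → T-not⇒¬T pu (from (DA (∁ u) a) λ q → ¬q (mono _ _ ∁∁⊆ a q))

    preimageᗮ⁺ : ∀ {u a} → T (P ⟪ dual A ⟫ u (toᗮ A a)) → T (P (⟪ A ⟫ ᗮ) (u ∘ toᗮ A) a)
    preimageᗮ⁺ {u} {a} = ¬T⇒T-not ∘ to (DA u a)

  duality-⊗ : ∀ A B → Duality A → Duality B → Duality (A ⊗ B)
  duality-⊗ A B DA DB x (a , b) = mk⇔
    (λ h pab → ω-elim pab λ { (u , v , u×v⊆ , pu , pv) → ¬ω-elim h
      (image (toᗮ A) u , image (toᗮ B) v , image-×⊆ (toᗮ A) (toᗮ B) (∁ x) u×v⊆ ,
       Transfer.image⁺ A DA pu , Transfer.image⁺ B DB pv) })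
    (λ ¬p → ¬ω-intro λ { (u , v , u×v⊆ , pu , pv) → ¬p (ω-intro
      (u ∘ toᗮ A , v ∘ toᗮ B , (λ a′ b′ → u×v⊆ (toᗮ A a′) (toᗮ B b′)) ,
       Transfer.preimage⁺ A DA pu , Transfer.preimage⁺ B DB pv)) })

  duality-⅋ : ∀ A B → Duality A → Duality B → Duality (A ⅋ B)
  duality-⅋ A B DA DB x (a , b) = mk⇔
    (λ h ¬p → ω-elim h λ { (u , v , u×v⊆ , pu , pv) → T-not⇒¬T ¬p (ω-intro
      (u ∘ toᗮ A , v ∘ toᗮ B , (λ a′ b′ ua vb → T-not-not⁺ (u×v⊆ _ _ ua vb)) ,
       Transfer.preimageᗮ⁺ A DA pu , Transfer.preimageᗮ⁺ B DB pv)) })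
    (λ ¬p → ω-map (λ { (u , v , u×v⊆ , pu , pv) →
      image (toᗮ A) u , image (toᗮ B) v ,
      image-×⊆ (toᗮ A) (toᗮ B) x (λ a b ua vb → T-not-not⁻ (u×v⊆ a b ua vb)) ,
      Transfer.imageᗮ⁺ A DA pu , Transfer.imageᗮ⁺ B DB pv })
      (T-stable (¬p ∘ ¬T⇒T-not)))

  duality-⊕ : ∀ A B → Duality A → Duality B → Duality (A ⊕ B)
  duality-⊕ A B DA DB x (inj₁ a) = mk⇔
    (λ p h → to (DA _ a) p (⟪⟫-monotone A _ _ ∁∁⊆ a (T-not-not⁻ h)))
    (λ ¬q → from (DA _ a) λ q → ¬q (T-not-not⁺ (⟪⟫-monotone A _ _ ⊆∁∁ a q)))
  duality-⊕ A B DA DB x (inj₂ b) = mk⇔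
    (λ p h → to (DB _ b) p (⟪⟫-monotone B _ _ ∁∁⊆ b (T-not-not⁻ h)))
    (λ ¬q → from (DB _ b) λ q → ¬q (T-not-not⁺ (⟪⟫-monotone B _ _ ⊆∁∁ b q)))

  duality-& : ∀ A B → Duality A → Duality B → Duality (A & B)
  duality-& A B DA DB x (inj₁ a) = mk⇔
    (λ h p → to (DA _ a) (T-not-not⁻ h) (⟪⟫-monotone A _ _ ⊆∁∁ a p))
    (λ ¬p → T-not-not⁺ (from (DA _ a) λ q → ¬p (⟪⟫-monotone A _ _ ∁∁⊆ a q)))
  duality-& A B DA DB x (inj₂ b) = mk⇔
    (λ h p → to (DB _ b) (T-not-not⁻ h) (⟪⟫-monotone B _ _ ⊆∁∁ b p))
    (λ ¬p → T-not-not⁺ (from (DB _ b) λ q → ¬p (⟪⟫-monotone B _ _ ∁∁⊆ b q)))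

  duality-! : ∀ A → Duality A → Duality (! A)
  duality-! A DA x as = mk⇔
    (λ h pas → ω-elim pas λ { (ys , ∏ys⊆ , pys) → ¬ω-elim h
      (map (image (toᗮ A)) ys , ∏-image (toᗮ A) ys (∁ x) ∏ys⊆ ,
       Pointwise-mapʳ⁺ (Pointwise-mapˡ⁺ (Pointwise.map (Transfer.image⁺ A DA) pys))) })
    (λ ¬p → ¬ω-intro λ { (xs , ∏xs⊆ , pxs) → ¬p (ω-intro
      (map (_∘ toᗮ A) xs , ∏-preimage (toᗮ A) xs (∁ x) ∏xs⊆ ,
       Pointwise-mapʳ⁺ (Pointwise.map (Transfer.preimage⁺ A DA) (Pointwise-mapˡ⁻ pxs)))) })

  duality-¿ : ∀ A → Duality A → Duality (¿ A)
  duality-¿ A DA x as = mk⇔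
    (λ h ¬p → ω-elim h λ { (xs , ∏xs⊆ , pxs) → T-not⇒¬T ¬p (ω-intro
      (map (_∘ toᗮ A) xs , (λ l e → T-not-not⁺ (∏-preimage (toᗮ A) xs x ∏xs⊆ l e)) ,
       Pointwise-mapʳ⁺ (Pointwise.map (Transfer.preimageᗮ⁺ A DA) (Pointwise-mapˡ⁻ pxs)))) })
    (λ ¬p → ω-map (λ { (ys , ∏ys⊆ , pys) →
      map (image (toᗮ A)) ys , ∏-image (toᗮ A) ys x (λ l e → T-not-not⁻ (∏ys⊆ l e)) ,
      Pointwise-mapʳ⁺ (Pointwise-mapˡ⁺ (Pointwise.map (Transfer.imageᗮ⁺ A DA) pys)) })
      (T-stable (¬p ∘ ¬T⇒T-not)))

  duality : ∀ A → Duality A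
  duality (var n) = ᗮ-P⇔ (ρ n)
  duality (var⊥ n) = ᗮᗮ-P⇔ (ρ n) (ρ-monotone n)
  duality 𝟎 x ()
  duality ⊤ᶠ x ()
  duality 𝟏 = ᗮ-P⇔ 𝟏I
  duality ⊥ᶠ = ᗮᗮ-P⇔ 𝟏I 𝟏-monotone
  duality (A ⊗ B) = duality-⊗ A B (duality A) (duality B)
  duality (A ⅋ B) = duality-⅋ A B (duality A) (duality B)
  duality (A ⊕ B) = duality-⊕ A B (duality A) (duality B)
  duality (A & B) = duality-& A B (duality A) (duality B)
  duality (! A) = duality-! A (duality A)
  duality (¿ A) = duality-¿ A (duality A)

  Invariant : (X : Interface) → (web X → web X → Set) → Set
  Invariant X E = ∀ {a a′} → E a a′ → ∀ x → T (P X x a) ⇔ T (P X x a′)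

  ᗮ-invariant : ∀ X E → Invariant X E → Invariant (X ᗮ) E
  ᗮ-invariant X E inv e x = mk⇔
    (λ h → ¬T⇒T-not (T-not⇒¬T h ∘ from (inv e (∁ x))))
    (λ h → ¬T⇒T-not (T-not⇒¬T h ∘ to (inv e (∁ x))))

  ⊗-invariant : ∀ X Y E E′ → Invariant X E → Invariant Y E′ →
    Invariant (X ⊗I Y) (λ p q → E (proj₁ p) (proj₁ q) × E′ (proj₂ p) (proj₂ q))
  ⊗-invariant X Y E E′ invX invY (ea , eb) r = mk⇔
    (ω-map λ { (x , y , x×y⊆r , px , py) → x , y , x×y⊆r , to (invX ea x) px , to (invY eb y) py })
    (ω-map λ { (x , y , x×y⊆r , px , py) → x , y , x×y⊆r , from (invX ea x) px , from (invY eb y) py })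

  !-invariant : ∀ X E → Invariant X E →
    Invariant (!I X) (λ l l′ → ∃ λ m → l ↭ m × Pointwise E m l′)
  !-invariant X E inv {l} {l′} (m , l↭m , m≈l′) U = mk⇔ (ω-map forth) (ω-map back)
    where
    Factorisation : List (web X) → Set
    Factorisation k = ∃ λ xs → ∏ xs U × Pointwise (λ a x → T (P X x a)) k xs

    forth : Factorisation l → Factorisation l′
    forth (xs , ∏xs⊆U , pxs) with Pointwise-↭ˡ pxs l↭m
    ... | ys , pys , xs↭ys =
      ys , ∏-resp-↭ ∏xs⊆U xs↭ys ,
      Pointwise.transitive (λ e p → to (inv e _) p) (Pointwise.symmetric (λ e → e) m≈l′) pys
    back : Factorisation l′ → Factorisation l
    back (ys , ∏ys⊆U , pys)
      with Pointwise-↭ˡ (Pointwise.transitive (λ e p → from (inv e _) p) m≈l′ pys) (↭-sym l↭m)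
    ... | xs , pxs , ys↭xs = xs , ∏-resp-↭ ∏ys⊆U ys↭xs , pxs

  ≡-invariant : ∀ X → Invariant X _≡_
  ≡-invariant X refl x = mk⇔ (λ p → p) (λ p → p)

  P-invariant : ∀ A → Invariant ⟪ A ⟫ (Eq ρ A)
  P-invariant (var n) = ≡-invariant _
  P-invariant (var⊥ n) = ≡-invariant _
  P-invariant 𝟎 = ≡-invariant _
  P-invariant ⊤ᶠ = ≡-invariant _
  P-invariant 𝟏 = ≡-invariant _
  P-invariant ⊥ᶠ = ≡-invariant _
  P-invariant (A ⊗ B) = ⊗-invariant ⟪ A ⟫ ⟪ B ⟫ (Eq ρ A) (Eq ρ B) (P-invariant A) (P-invariant B)
  P-invariant (A ⅋ B) =
    ᗮ-invariant ((⟪ A ⟫ ᗮ) ⊗I (⟪ B ⟫ ᗮ)) _ (⊗-invariant (⟪ A ⟫ ᗮ) (⟪ B ⟫ ᗮ) (Eq ρ A) (Eq ρ B)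
      (ᗮ-invariant ⟪ A ⟫ _ (P-invariant A)) (ᗮ-invariant ⟪ B ⟫ _ (P-invariant B)))
  P-invariant (A ⊕ B) {inj₁ a} {inj₁ a′} e x =
    ᗮ-invariant (⟪ A ⟫ ᗮ) _ (ᗮ-invariant ⟪ A ⟫ _ (P-invariant A)) e (x ∘ inj₁)
  P-invariant (A ⊕ B) {inj₂ b} {inj₂ b′} e x =
    ᗮ-invariant (⟪ B ⟫ ᗮ) _ (ᗮ-invariant ⟪ B ⟫ _ (P-invariant B)) e (x ∘ inj₂)
  P-invariant (A & B) {inj₁ a} {inj₁ a′} e x = P-invariant A e (x ∘ inj₁)
  P-invariant (A & B) {inj₂ b} {inj₂ b′} e x = P-invariant B e (x ∘ inj₂)
  P-invariant (! A) = !-invariant ⟪ A ⟫ (Eq ρ A) (P-invariant A)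
  P-invariant (¿ A) =
    ᗮ-invariant (!I (⟪ A ⟫ ᗮ)) _ (!-invariant (⟪ A ⟫ ᗮ) (Eq ρ A) (ᗮ-invariant ⟪ A ⟫ _ (P-invariant A)))

  Eq-refl : ∀ A a → Eq ρ A a a
  Eq-refl (var n) a = refl
  Eq-refl (var⊥ n) a = refl
  Eq-refl 𝟎 a = refl
  Eq-refl ⊤ᶠ a = refl
  Eq-refl 𝟏 a = refl
  Eq-refl ⊥ᶠ a = refl
  Eq-refl (A ⊗ B) (a , b) = Eq-refl A a , Eq-refl B b
  Eq-refl (A ⅋ B) (a , b) = Eq-refl A a , Eq-refl B b
  Eq-refl (A ⊕ B) (inj₁ a) = Eq-refl A a
  Eq-refl (A ⊕ B) (inj₂ b) = Eq-refl B b
  Eq-refl (A & B) (inj₁ a) = Eq-refl A a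
  Eq-refl (A & B) (inj₂ b) = Eq-refl B b
  Eq-refl (! A) l = l , ↭-refl , Pointwise.refl (Eq-refl A _)
  Eq-refl (¿ A) l = l , ↭-refl , Pointwise.refl (Eq-refl A _)

  ax-seed : ∀ A → SeedByTests (dual A ∷ A ∷ []) ⟪ ax {A} ⟫ᵖ
  ax-seed A (b , a , tt) h (x , y , tt) cov ¬hit = ω-elim h λ b≈a →
    ¬hit (inj₁ (from (P-invariant (dual A) b≈a x) (from (duality A x a) λ p →
      ¬hit (inj₂ (inj₁ (⟪⟫-monotone A _ _ ∁x⊆y a p))))))
    where
    ∁x⊆y : ∁ (x ∘ toᗮ A) ⊆ y
    ∁x⊆y a′ h′ = T-stable λ ¬y → cov (toᗮ A a′ , a′ , tt) (ω-intro (Eq-refl (dual A) (toᗮ A a′)))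
      [ T-not⇒¬T h′ , [ ¬y , (λ ()) ] ]

  -- P 𝟏I is the identity, so a cover is already a hit.
  one-seed : SeedByTests (𝟏 ∷ []) ⟪ one ⟫ᵖ
  one-seed e h t cov = cov e h

  bot-seed : ∀ {Γ} (π : ⊢ Γ) → SeedByTests Γ ⟪ π ⟫ᵖ → SeedByTests (⊥ᶠ ∷ Γ) ⟪ bot π ⟫ᵖ
  bot-seed π π-seed (tt , γ) h (x , t) cov ¬hit =
    π-seed γ h t (λ γ′ r′ ¬hit′ → cov (tt , γ′) r′ [ ¬hit ∘ inj₁ ∘ T-not-not⁺ , ¬hit′ ])
      (¬hit ∘ inj₂)

  top-seed : ∀ {Γ} → SeedByTests (⊤ᶠ ∷ Γ) ⟪ top {Γ} ⟫ᵖ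
  top-seed e ()

  par-seed : ∀ {A B Γ} (π : ⊢ A ∷ B ∷ Γ) → SeedByTests (A ∷ B ∷ Γ) ⟪ π ⟫ᵖ →
    SeedByTests (A ⅋ B ∷ Γ) ⟪ par π ⟫ᵖ
  par-seed {A} {B} π π-seed ((a , b) , γ) h (w , t) cov ¬hit =
    ¬hit (inj₁ (⅋-P-intro ⟪ A ⟫ ⟪ B ⟫ w a b λ x y x×y-cov ¬p →
      π-seed (a , b , γ) h (x , y , t)
        (λ { (a′ , b′ , γ′) r′ ¬hit′ → cov ((a′ , b′) , γ′) r′
              [ (λ wab → x×y-cov a′ b′ wab [ ¬hit′ ∘ inj₁ , ¬hit′ ∘ inj₂ ∘ inj₁ ]) ,
                ¬hit′ ∘ inj₂ ∘ inj₂ ] })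
        [ ¬p ∘ inj₁ , [ ¬p ∘ inj₂ , ¬hit ∘ inj₂ ] ]))

  with-seed : ∀ {A B Γ} (π₁ : ⊢ A ∷ Γ) (π₂ : ⊢ B ∷ Γ) →
    SeedByTests (A ∷ Γ) ⟪ π₁ ⟫ᵖ → SeedByTests (B ∷ Γ) ⟪ π₂ ⟫ᵖ →
    SeedByTests (A & B ∷ Γ) ⟪ with' π₁ π₂ ⟫ᵖ
  with-seed π₁ π₂ π₁-seed π₂-seed (inj₁ a , γ) h (x , t) cov =
    π₁-seed (a , γ) h (x ∘ inj₁ , t) λ { (a′ , γ′) → cov (inj₁ a′ , γ′) }
  with-seed π₁ π₂ π₁-seed π₂-seed (inj₂ b , γ) h (x , t) cov =
    π₂-seed (b , γ) h (x ∘ inj₂ , t) λ { (b′ , γ′) → cov (inj₂ b′ , γ′) }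

  plus₁-seed : ∀ {A B Γ} (π : ⊢ A ∷ Γ) → SeedByTests (A ∷ Γ) ⟪ π ⟫ᵖ →
    SeedByTests (A ⊕ B ∷ Γ) ⟪ plus₁ {A} {B} π ⟫ᵖ
  plus₁-seed {A} π π-seed (inj₁ a , γ) h (x , t) cov ¬hit =
    π-seed (a , γ) h (x ∘ inj₁ , t) (λ { (a′ , γ′) → cov (inj₁ a′ , γ′) })
      [ ¬hit ∘ inj₁ ∘ T-not-not⁺ ∘ ⟪⟫-monotone A _ _ ⊆∁∁ a , ¬hit ∘ inj₂ ]
  plus₁-seed π π-seed (inj₂ b , γ) ()

  plus₂-seed : ∀ {A B Γ} (π : ⊢ B ∷ Γ) → SeedByTests (B ∷ Γ) ⟪ π ⟫ᵖ →
    SeedByTests (A ⊕ B ∷ Γ) ⟪ plus₂ {A} {B} π ⟫ᵖ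
  plus₂-seed {B = B} π π-seed (inj₂ b , γ) h (x , t) cov ¬hit =
    π-seed (b , γ) h (x ∘ inj₂ , t) (λ { (b′ , γ′) → cov (inj₂ b′ , γ′) })
      [ ¬hit ∘ inj₁ ∘ T-not-not⁺ ∘ ⟪⟫-monotone B _ _ ⊆∁∁ b , ¬hit ∘ inj₂ ]
  plus₂-seed π π-seed (inj₁ a , γ) ()

  der-seed : ∀ {A Γ} (π : ⊢ A ∷ Γ) → SeedByTests (A ∷ Γ) ⟪ π ⟫ᵖ →
    SeedByTests (¿ A ∷ Γ) ⟪ der π ⟫ᵖ
  der-seed {A} π π-seed (a ∷ [] , γ) h (x , t) cov ¬hit =
    π-seed (a , γ) h ((λ a′ → x (a′ ∷ [])) , t) (λ { (a′ , γ′) → cov (a′ ∷ [] , γ′) })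
      [ (λ p → ¬hit (inj₁ (¬ω-intro λ { (u ∷ [] , ∏u⊆∁x , pu ∷ []) →
          T-not⇒¬T pu (⟪⟫-monotone A _ _ (x[-]⊆∁u u ∏u⊆∁x) a p) }))) ,
        ¬hit ∘ inj₂ ]
    where
    x[-]⊆∁u : ∀ u → ∏ (u ∷ []) (∁ x) → (λ a′ → x (a′ ∷ [])) ⊆ ∁ u
    x[-]⊆∁u u ∏u⊆∁x a′ xa = ¬T⇒T-not λ ua →
      T-not⇒¬T (∏u⊆∁x (a′ ∷ []) (a′ ∷ [] , ua ∷ [] , ↭-refl)) xa

  weak-seed : ∀ {A Γ} (π : ⊢ Γ) → SeedByTests Γ ⟪ π ⟫ᵖ → SeedByTests (¿ A ∷ Γ) ⟪ weak {A} π ⟫ᵖ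
  weak-seed π π-seed ([] , γ) h (x , t) cov ¬hit =
    π-seed γ h t (λ γ′ r′ ¬hit′ → cov ([] , γ′) r′ [ ¬x[] , ¬hit′ ]) (¬hit ∘ inj₂)
    where
    ¬x[] : ¬ T (x [])
    ¬x[] x[] = ¬hit (inj₁ (¬ω-intro λ { ([] , ∏[]⊆∁x , []) →
      T-not⇒¬T (∏[]⊆∁x [] ([] , [] , ↭-refl)) x[] }))

  permTests : ∀ {Γ Δ} → Γ ↭ Δ → Tests Δ → Tests Γ
  permTests ↭.refl t = t
  permTests (prep A p) (x , t) = x , permTests p t
  permTests (swap A B p) (y , x , t) = x , y , permTests p t
  permTests (↭.trans p q) t = permTests p (permTests q t)

  permElem⁻¹ : ∀ {Γ Δ} → Γ ↭ Δ → Elem ρ Γ → Elem ρ Δ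
  permElem⁻¹ ↭.refl e = e
  permElem⁻¹ (prep A p) (a , e) = a , permElem⁻¹ p e
  permElem⁻¹ (swap A B p) (a , b , e) = b , a , permElem⁻¹ p e
  permElem⁻¹ (↭.trans p q) e = permElem⁻¹ q (permElem⁻¹ p e)

  permElem∘permElem⁻¹ : ∀ {Γ Δ} (p : Γ ↭ Δ) e → permElem ρ p (permElem⁻¹ p e) ≡ e
  permElem∘permElem⁻¹ ↭.refl e = refl
  permElem∘permElem⁻¹ (prep A p) (a , e) = cong (a ,_) (permElem∘permElem⁻¹ p e)
  permElem∘permElem⁻¹ (swap A B p) (a , b , e) = cong (λ e′ → a , b , e′) (permElem∘permElem⁻¹ p e)
  permElem∘permElem⁻¹ (↭.trans p q) e
    rewrite permElem∘permElem⁻¹ q (permElem⁻¹ p e) = permElem∘permElem⁻¹ p e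

  module _ (Q : ∀ A → Subset ∣ A ∣ᶠ → ∣ A ∣ᶠ → Set) where

    Somewhere-permute⁺ : ∀ {Γ Δ} (p : Γ ↭ Δ) t e →
      Somewhere Q Γ (permTests p t) (permElem ρ p e) → Somewhere Q Δ t e
    Somewhere-permute⁺ ↭.refl t e = λ q → q
    Somewhere-permute⁺ (prep A p) (x , t) (a , e) = map₂ (Somewhere-permute⁺ p t e)
    Somewhere-permute⁺ (swap A B p) (y , x , t) (b , a , e) =
      [ inj₂ ∘ inj₁ , [ inj₁ , inj₂ ∘ inj₂ ∘ Somewhere-permute⁺ p t e ] ]
    Somewhere-permute⁺ (↭.trans p q) t e =
      Somewhere-permute⁺ q t e ∘ Somewhere-permute⁺ p (permTests q t) (permElem ρ q e)

    Somewhere-permute⁻ : ∀ {Γ Δ} (p : Γ ↭ Δ) t e →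
      Somewhere Q Δ t e → Somewhere Q Γ (permTests p t) (permElem ρ p e)
    Somewhere-permute⁻ ↭.refl t e = λ q → q
    Somewhere-permute⁻ (prep A p) (x , t) (a , e) = map₂ (Somewhere-permute⁻ p t e)
    Somewhere-permute⁻ (swap A B p) (y , x , t) (b , a , e) =
      [ inj₂ ∘ inj₁ , [ inj₁ , inj₂ ∘ inj₂ ∘ Somewhere-permute⁻ p t e ] ]
    Somewhere-permute⁻ (↭.trans p q) t e =
      Somewhere-permute⁻ p (permTests q t) (permElem ρ q e) ∘ Somewhere-permute⁻ q t e

  ex-seed : ∀ {Γ Δ} (p : Γ ↭ Δ) (π : ⊢ Γ) → SeedByTests Γ ⟪ π ⟫ᵖ → SeedByTests Δ ⟪ ex p π ⟫ᵖ
  ex-seed {Γ} p π π-seed e h t cov ¬hit =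
    π-seed (permElem ρ p e) h (permTests p t) cov′ (¬hit ∘ Somewhere-permute⁺ _ p t e)
    where
    cov′ : Covers Γ (permTests p t) ⟪ π ⟫ᵖ
    cov′ e′ r′ ¬hit′ =
      cov (permElem⁻¹ p e′) (subst (T ∘ ⟪ π ⟫ᵖ) (sym (permElem∘permElem⁻¹ p e′)) r′)
        (¬hit′ ∘ subst (Hit Γ (permTests p t)) (permElem∘permElem⁻¹ p e′)
               ∘ Somewhere-permute⁻ _ p t (permElem⁻¹ p e′))

  append : ∀ Γ Δ → Elem ρ Γ → Elem ρ Δ → Elem ρ (Γ ++ Δ)
  append [] Δ _ δ = δ
  append (A ∷ Γ) Δ (a , γ) δ = a , append Γ Δ γ δ

  append-surjective : ∀ Γ Δ (e : Elem ρ (Γ ++ Δ)) → ∃₂ λ γ δ → append Γ Δ γ δ ≡ e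
  append-surjective [] Δ e = tt , e , refl
  append-surjective (A ∷ Γ) Δ (a , e) with append-surjective Γ Δ e
  ... | γ , δ , refl = (a , γ) , δ , refl

  split-append : ∀ Γ Δ (γ : Elem ρ Γ) (δ : Elem ρ Δ) → split ρ Γ {Δ} (append Γ Δ γ δ) ≡ (γ , δ)
  split-append [] Δ γ δ = refl
  split-append (A ∷ Γ) Δ (a , γ) δ rewrite split-append Γ Δ γ δ = refl

  appendTests : ∀ Γ Δ → Tests Γ → Tests Δ → Tests (Γ ++ Δ)
  appendTests [] Δ _ tΔ = tΔ
  appendTests (A ∷ Γ) Δ (x , tΓ) tΔ = x , appendTests Γ Δ tΓ tΔ

  appendTests-surjective : ∀ Γ Δ (t : Tests (Γ ++ Δ)) → ∃₂ λ tΓ tΔ → appendTests Γ Δ tΓ tΔ ≡ t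
  appendTests-surjective [] Δ t = tt , t , refl
  appendTests-surjective (A ∷ Γ) Δ (x , t) with appendTests-surjective Γ Δ t
  ... | tΓ , tΔ , refl = (x , tΓ) , tΔ , refl

  module _ (Q : ∀ A → Subset ∣ A ∣ᶠ → ∣ A ∣ᶠ → Set) where

    Somewhere-++⁻ : ∀ Γ Δ tΓ tΔ γ δ → Somewhere Q (Γ ++ Δ) (appendTests Γ Δ tΓ tΔ) (append Γ Δ γ δ) →
      Somewhere Q Γ tΓ γ ⊎ Somewhere Q Δ tΔ δ
    Somewhere-++⁻ [] Δ tΓ tΔ γ δ = inj₂
    Somewhere-++⁻ (A ∷ Γ) Δ (x , tΓ) tΔ (a , γ) δ =
      [ inj₁ ∘ inj₁ , map₁ inj₂ ∘ Somewhere-++⁻ Γ Δ tΓ tΔ γ δ ]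

    Somewhere-++⁺ : ∀ Γ Δ tΓ tΔ γ δ → Somewhere Q Γ tΓ γ ⊎ Somewhere Q Δ tΔ δ →
      Somewhere Q (Γ ++ Δ) (appendTests Γ Δ tΓ tΔ) (append Γ Δ γ δ)
    Somewhere-++⁺ [] Δ tΓ tΔ γ δ = [ (λ ()) , (λ q → q) ]
    Somewhere-++⁺ (A ∷ Γ) Δ (x , tΓ) tΔ (a , γ) δ =
      [ [ inj₁ , inj₂ ∘ Somewhere-++⁺ Γ Δ tΓ tΔ γ δ ∘ inj₁ ] ,
        inj₂ ∘ Somewhere-++⁺ Γ Δ tΓ tΔ γ δ ∘ inj₂ ]

  residual : ∀ A Γ → Subset (Elem ρ (A ∷ Γ)) → Tests Γ → Subset ∣ A ∣ᶠ
  residual A Γ r t a = ω (∃ λ γ → T (r (a , γ)) × ¬ Hit Γ t γ)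

  residual-P : ∀ A Γ {r : Subset (Elem ρ (A ∷ Γ))} → SeedByTests (A ∷ Γ) r →
    ∀ {a γ} t → T (r (a , γ)) → ¬ Hitᴾ Γ t γ → T (P ⟪ A ⟫ (residual A Γ r t) a)
  residual-P A Γ r-seed {a} {γ} t h ¬hit = T-stable λ ¬p →
    r-seed (a , γ) h (residual A Γ _ t , t)
      (λ { (a′ , γ′) r′ ¬hit′ → ¬hit′ (inj₁ (ω-intro (γ′ , r′ , ¬hit′ ∘ inj₂))) })
      [ ¬p , ¬hit ]

  cut-append : ∀ {A Γ Δ} (π₁ : ⊢ A ∷ Γ) (π₂ : ⊢ dual A ∷ Δ) γ δ →
    ⟪ cut π₁ π₂ ⟫ᵖ (append Γ Δ γ δ) ≡
      ω (∃ λ a → T (⟪ π₁ ⟫ᵖ (a , γ)) × T (⟪ π₂ ⟫ᵖ (toᗮ A a , δ)))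
  cut-append {Γ = Γ} {Δ} π₁ π₂ γ δ rewrite split-append Γ Δ γ δ = refl

  cut-seed : ∀ {A Γ Δ} (π₁ : ⊢ A ∷ Γ) (π₂ : ⊢ dual A ∷ Δ) →
    SeedByTests (A ∷ Γ) ⟪ π₁ ⟫ᵖ → SeedByTests (dual A ∷ Δ) ⟪ π₂ ⟫ᵖ →
    SeedByTests (Γ ++ Δ) ⟪ cut π₁ π₂ ⟫ᵖ
  cut-seed {A} {Γ} {Δ} π₁ π₂ π₁-seed π₂-seed e h t cov ¬hit
    with append-surjective Γ Δ e | appendTests-surjective Γ Δ t
  ... | γ , δ , refl | tΓ , tΔ , refl =
    ω-elim (subst T (cut-append π₁ π₂ γ δ) h) λ { (a , r₁ , r₂) →
      to (duality A y a)
        (residual-P (dual A) Δ π₂-seed tΔ r₂ (¬hit ∘ Somewhere-++⁺ _ Γ Δ tΓ tΔ γ δ ∘ inj₂))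
        (⟪⟫-monotone A _ _ x⊆∁y a
          (residual-P A Γ π₁-seed tΓ r₁ (¬hit ∘ Somewhere-++⁺ _ Γ Δ tΓ tΔ γ δ ∘ inj₁))) }
    where
    x : Subset ∣ A ∣ᶠ
    x = residual A Γ ⟪ π₁ ⟫ᵖ tΓ
    y : Subset ∣ dual A ∣ᶠ
    y = residual (dual A) Δ ⟪ π₂ ⟫ᵖ tΔ
    x⊆∁y : x ⊆ ∁ (y ∘ toᗮ A)
    x⊆∁y a′ xa = ¬T⇒T-not λ ya →
      ω-elim xa λ { (γ′ , r₁′ , ¬hitΓ) → ω-elim ya λ { (δ′ , r₂′ , ¬hitΔ) →
        cov (append Γ Δ γ′ δ′) (subst T (sym (cut-append π₁ π₂ γ′ δ′)) (ω-intro (a′ , r₁′ , r₂′)))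
          ([ ¬hitΓ , ¬hitΔ ] ∘ Somewhere-++⁻ _ Γ Δ tΓ tΔ γ′ δ′) } }

  tens-append : ∀ {A B Γ Δ} (π₁ : ⊢ A ∷ Γ) (π₂ : ⊢ B ∷ Δ) a b γ δ →
    ⟪ tens π₁ π₂ ⟫ᵖ ((a , b) , append Γ Δ γ δ) ≡ ⟪ π₁ ⟫ᵖ (a , γ) ∧ ⟪ π₂ ⟫ᵖ (b , δ)
  tens-append {Γ = Γ} {Δ} π₁ π₂ a b γ δ rewrite split-append Γ Δ γ δ = refl

  tens-seed : ∀ {A B Γ Δ} (π₁ : ⊢ A ∷ Γ) (π₂ : ⊢ B ∷ Δ) →
    SeedByTests (A ∷ Γ) ⟪ π₁ ⟫ᵖ → SeedByTests (B ∷ Δ) ⟪ π₂ ⟫ᵖ →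
    SeedByTests (A ⊗ B ∷ Γ ++ Δ) ⟪ tens π₁ π₂ ⟫ᵖ
  tens-seed {A} {B} {Γ} {Δ} π₁ π₂ π₁-seed π₂-seed ((a , b) , e) h (w , t) cov ¬hit
    with append-surjective Γ Δ e | appendTests-surjective Γ Δ t
  ... | γ , δ , refl | tΓ , tΔ , refl =
    let (r₁ , r₂) = to T-∧ (subst T (tens-append π₁ π₂ a b γ δ) h) in
    ¬hit (inj₁ (ω-intro (x , y , x×y⊆w ,
      residual-P A Γ π₁-seed tΓ r₁ (¬hit ∘ inj₂ ∘ Somewhere-++⁺ _ Γ Δ tΓ tΔ γ δ ∘ inj₁) ,
      residual-P B Δ π₂-seed tΔ r₂ (¬hit ∘ inj₂ ∘ Somewhere-++⁺ _ Γ Δ tΓ tΔ γ δ ∘ inj₂))))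
    where
    x : Subset ∣ A ∣ᶠ
    x = residual A Γ ⟪ π₁ ⟫ᵖ tΓ
    y : Subset ∣ B ∣ᶠ
    y = residual B Δ ⟪ π₂ ⟫ᵖ tΔ
    x×y⊆w : ∀ a′ b′ → T (x a′) → T (y b′) → T (w (a′ , b′))
    x×y⊆w a′ b′ xa yb = T-stable λ ¬w →
      ω-elim xa λ { (γ′ , r₁′ , ¬hitΓ) → ω-elim yb λ { (δ′ , r₂′ , ¬hitΔ) →
        cov ((a′ , b′) , append Γ Δ γ′ δ′)
          (subst T (sym (tens-append π₁ π₂ a′ b′ γ′ δ′)) (from T-∧ (r₁′ , r₂′)))
          [ ¬w , [ ¬hitΓ , ¬hitΔ ] ∘ Somewhere-++⁻ _ Γ Δ tΓ tΔ γ′ δ′ ] } }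

  ∏set : {A : Set} → List (Subset A) → Subset (List A)
  ∏set zs l = ω (∃ λ bs → bs ∈ᴾ zs × l ↭ bs)

  ∏set⊆ : {A : Set} {zs : List (Subset A)} {U : Subset (List A)} → ∏ zs U → ∏set zs ⊆ U
  ∏set⊆ ∏zs⊆U l l∈ = T-stable λ ¬Ul → ω-elim l∈ (¬Ul ∘ ∏zs⊆U l)

  ∏⊆∁∁∏set : {A : Set} (zs : List (Subset A)) → ∏ zs (∁ (∁ (∏set zs)))
  ∏⊆∁∁∏set zs l l∈ = T-not-not⁺ (ω-intro l∈)

  ∏set-++ : {A : Set} {ys₁ ys₂ : List (Subset A)} {k k′ : List A} →
    T (∏set ys₁ k) → T (∏set ys₂ k′) → T (∏set (ys₁ ++ ys₂) (k ++ k′))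
  ∏set-++ k∈ k′∈ = T-stable λ ¬∈ →
    ω-elim k∈ λ { (bs₁ , bs₁∈ , k↭bs₁) → ω-elim k′∈ λ { (bs₂ , bs₂∈ , k′↭bs₂) →
      ¬∈ (ω-intro (bs₁ ++ bs₂ , Pointwise.++⁺ bs₁∈ bs₂∈ , ↭ₚ.++⁺ k↭bs₁ k′↭bs₂)) } }

  -- l ∉ P ⟪ ¿ A ⟫ y is witnessed by some ys with ∏ ys ⊆ ∁ y and Pᗮ* A l ys.
  Pᗮ* : ∀ A → List ∣ A ∣ᶠ → List (Subset ∣ A ∣ᶠ) → Set
  Pᗮ* A l ys = Pointwise (λ a u → T (P (⟪ A ⟫ ᗮ) u a)) l ys

  ∁∏set-¬P¿ : ∀ A {l ys} → Pᗮ* A l ys → ¬ T (P ⟪ ¿ A ⟫ (∁ (∏set ys)) l)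
  ∁∏set-¬P¿ A {ys = ys} pl p = T-not⇒¬T p (ω-intro (ys , ∏⊆∁∁∏set ys , pl))

  contr-seed : ∀ {A Γ} (π : ⊢ ¿ A ∷ ¿ A ∷ Γ) → SeedByTests (¿ A ∷ ¿ A ∷ Γ) ⟪ π ⟫ᵖ →
    SeedByTests (¿ A ∷ Γ) ⟪ contr π ⟫ᵖ
  contr-seed {A} {Γ} π π-seed (m , γ) h (x , t) cov ¬hit =
    ω-elim h λ { (l , l′ , m↭l++l′ , r) →
      ¬hit (inj₁ (¬ω-intro λ { (xs , ∏xs⊆∁x , pm) → refute l l′ m↭l++l′ r xs ∏xs⊆∁x pm })) }
    where
    refute : ∀ l l′ → m ↭ l ++ l′ → T (⟪ π ⟫ᵖ (l , l′ , γ)) →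
      ∀ xs → ∏ xs (∁ x) → Pᗮ* A m xs → ⊥
    refute l l′ m↭l++l′ r xs ∏xs⊆∁x pm with Pointwise-↭ˡ pm m↭l++l′
    ... | ys , pys , xs↭ys with Pointwise-++ˡ⁻ l pys
    ... | ys₁ , ys₂ , refl , pys₁ , pys₂ =
      π-seed (l , l′ , γ) r (∁ (∏set ys₁) , ∁ (∏set ys₂) , t) cov′
        [ ∁∏set-¬P¿ A pys₁ , [ ∁∏set-¬P¿ A pys₂ , ¬hit ∘ inj₂ ] ]
      where
      cov′ : Covers (¿ A ∷ ¿ A ∷ Γ) (∁ (∏set ys₁) , ∁ (∏set ys₂) , t) ⟪ π ⟫ᵖ
      cov′ (k , k′ , γ′) r′ ¬hit′ =
        cov (k ++ k′ , γ′) (ω-intro (k , k′ , ↭-refl , r′))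
          [ T-not⇒¬T (∏set⊆ (∏-resp-↭ ∏xs⊆∁x xs↭ys) (k ++ k′)
              (∏set-++ (T-stable (¬hit′ ∘ inj₁ ∘ ¬T⇒T-not))
                       (T-stable (¬hit′ ∘ inj₂ ∘ inj₁ ∘ ¬T⇒T-not)))) ,
            ¬hit′ ∘ inj₂ ∘ inj₂ ]

  Factors : List Formula → Set
  Factors [] = ⊤
  Factors (B ∷ Γ) = List (Subset ∣ B ∣ᶠ) × Factors Γ

  addᶠ : ∀ Γ → Factors Γ → Factors Γ → Factors Γ
  addᶠ [] _ _ = tt
  addᶠ (B ∷ Γ) (zs , Z) (zs′ , Z′) = zs ++ zs′ , addᶠ Γ Z Z′

  addᵉ : ∀ Γ → Elem ρ (map ¿_ Γ) → Elem ρ (map ¿_ Γ) → Elem ρ (map ¿_ Γ)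
  addᵉ [] _ _ = tt
  addᵉ (B ∷ Γ) (l , g) (l′ , g′) = l ++ l′ , addᵉ Γ g g′

  ∁∏sets : ∀ Γ → Factors Γ → Tests (map ¿_ Γ)
  ∁∏sets [] _ = tt
  ∁∏sets (B ∷ Γ) (zs , Z) = ∁ (∏set zs) , ∁∏sets Γ Z

  All∏set : ∀ Γ → Factors Γ → Elem ρ (map ¿_ Γ) → Set
  All∏set [] _ _ = ⊤
  All∏set (B ∷ Γ) (zs , Z) (l , g) = T (∏set zs l) × All∏set Γ Z g

  AllPᗮ* : ∀ Γ → Factors Γ → Elem ρ (map ¿_ Γ) → Set
  AllPᗮ* [] _ _ = ⊤
  AllPᗮ* (B ∷ Γ) (zs , Z) (l , g) = Pᗮ* B l zs × AllPᗮ* Γ Z g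

  All∏⊆∁ : ∀ Γ → Tests (map ¿_ Γ) → Factors Γ → Set
  All∏⊆∁ [] _ _ = ⊤
  All∏⊆∁ (B ∷ Γ) (y , t) (zs , Z) = ∏ zs (∁ y) × All∏⊆∁ Γ t Z

  sumᵉ-∷ : ∀ Γ g gs → sumᵉ ρ Γ (g ∷ gs) ≡ addᵉ Γ g (sumᵉ ρ Γ gs)
  sumᵉ-∷ [] g gs = refl
  sumᵉ-∷ (B ∷ Γ) (l , g) gs = cong (l ++ concat (map proj₁ gs) ,_) (sumᵉ-∷ Γ g (map proj₂ gs))

  sumᵉ-↭ : ∀ Γ {gs gs′} → gs ↭ gs′ → PermEq ρ Γ (sumᵉ ρ Γ gs) (sumᵉ ρ Γ gs′)
  sumᵉ-↭ [] p = tt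
  sumᵉ-↭ (B ∷ Γ) p = concat⁺-↭ (↭ₚ.map⁺ proj₁ p) , sumᵉ-↭ Γ (↭ₚ.map⁺ proj₂ p)

  All∏set-add : ∀ Γ {Z₀ Z₁ h h′} → All∏set Γ Z₀ h → All∏set Γ Z₁ h′ →
    All∏set Γ (addᶠ Γ Z₀ Z₁) (addᵉ Γ h h′)
  All∏set-add [] _ _ = tt
  All∏set-add (B ∷ Γ) (k∈ , ks∈) (k′∈ , ks′∈) = ∏set-++ k∈ k′∈ , All∏set-add Γ ks∈ ks′∈

  All∏set-sum[] : ∀ Γ Z → AllPᗮ* Γ Z (sumᵉ ρ Γ []) → All∏set Γ Z (sumᵉ ρ Γ [])
  All∏set-sum[] [] Z _ = tt
  All∏set-sum[] (B ∷ Γ) ([] , Z) ([] , pZ) = ω-intro ([] , [] , ↭-refl) , All∏set-sum[] Γ Z pZ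

  AllPᗮ*-add⁻ : ∀ Γ Z g g′ → AllPᗮ* Γ Z (addᵉ Γ g g′) →
    ∃₂ λ Z₀ Z₁ → Z ≡ addᶠ Γ Z₀ Z₁ × AllPᗮ* Γ Z₀ g × AllPᗮ* Γ Z₁ g′
  AllPᗮ*-add⁻ [] Z g g′ _ = tt , tt , refl , tt , tt
  AllPᗮ*-add⁻ (B ∷ Γ) (zs , Z) (l , g) (l′ , g′) (pl , pZ)
    with Pointwise-++ˡ⁻ l pl | AllPᗮ*-add⁻ Γ Z g g′ pZ
  ... | ys₀ , ys₁ , refl , pl₀ , pl₁ | Z₀ , Z₁ , refl , pZ₀ , pZ₁ =
    (ys₀ , Z₀) , (ys₁ , Z₁) , refl , (pl₀ , pZ₀) , (pl₁ , pZ₁)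

  AllPᗮ*-resp-PermEq : ∀ Γ t Z g g′ → PermEq ρ Γ g g′ → All∏⊆∁ Γ t Z → AllPᗮ* Γ Z g →
    ∃ λ Z′ → All∏⊆∁ Γ t Z′ × AllPᗮ* Γ Z′ g′
  AllPᗮ*-resp-PermEq [] t Z g g′ _ _ _ = tt , tt , tt
  AllPᗮ*-resp-PermEq (B ∷ Γ) (y , t) (zs , Z) (l , g) (l′ , g′) (l↭l′ , g≈g′) (∏zs⊆ , Z⊆) (pl , pZ)
    with Pointwise-↭ˡ pl l↭l′ | AllPᗮ*-resp-PermEq Γ t Z g g′ g≈g′ Z⊆ pZ
  ... | ys , pl′ , zs↭ys | Z′ , Z′⊆ , pZ′ = (ys , Z′) , (∏-resp-↭ ∏zs⊆ zs↭ys , Z′⊆) , (pl′ , pZ′)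

  AllPᗮ*-of-¬Hitᴾ : ∀ Γ t g → ¬ Hitᴾ (map ¿_ Γ) t g → ¬ ¬ ∃ λ Z → All∏⊆∁ Γ t Z × AllPᗮ* Γ Z g
  AllPᗮ*-of-¬Hitᴾ [] t g _ k = k (tt , tt , tt)
  AllPᗮ*-of-¬Hitᴾ (B ∷ Γ) (y , t) (l , g) ¬hit k =
    ω-elim (T-stable (¬hit ∘ inj₁ ∘ ¬T⇒T-not)) λ { (ys , ∏ys⊆ , pl) →
      AllPᗮ*-of-¬Hitᴾ Γ t g (¬hit ∘ inj₂) λ { (Z , Z⊆ , pZ) → k ((ys , Z) , (∏ys⊆ , Z⊆) , (pl , pZ)) } }

  AllPᗮ*⇒¬Hitᴾ : ∀ Γ Z g → AllPᗮ* Γ Z g → ¬ Hitᴾ (map ¿_ Γ) (∁∏sets Γ Z) g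
  AllPᗮ*⇒¬Hitᴾ [] _ _ _ ()
  AllPᗮ*⇒¬Hitᴾ (B ∷ Γ) (zs , Z) (l , g) (pl , pZ) = [ ∁∏set-¬P¿ B pl , AllPᗮ*⇒¬Hitᴾ Γ Z g pZ ]

  ¬Hit⇒All∏set : ∀ Γ Z g → ¬ Hit (map ¿_ Γ) (∁∏sets Γ Z) g → All∏set Γ Z g
  ¬Hit⇒All∏set [] _ _ _ = tt
  ¬Hit⇒All∏set (B ∷ Γ) (zs , Z) (l , g) ¬hit =
    T-stable (¬hit ∘ inj₁ ∘ ¬T⇒T-not) , ¬Hit⇒All∏set Γ Z g (¬hit ∘ inj₂)

  All∏set⇒¬Hit : ∀ Γ t Z g → All∏⊆∁ Γ t Z → All∏set Γ Z g → ¬ Hit (map ¿_ Γ) t g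
  All∏set⇒¬Hit [] _ _ _ _ _ ()
  All∏set⇒¬Hit (B ∷ Γ) (y , t) (zs , Z) (l , g) (∏zs⊆ , Z⊆) (l∈ , g∈) =
    [ T-not⇒¬T (∏set⊆ ∏zs⊆ l l∈) , All∏set⇒¬Hit Γ t Z g Z⊆ g∈ ]

  -- The factorisation witnessing γ ∉ P(t) is split along γ ≈ Σ gs; the part
  -- belonging to gᵢ yields a residual uᵢ ∋ aᵢ, and the uᵢ factor a
  -- neighbourhood of as in P(x).
  module Promotion {A Γ} (π : ⊢ A ∷ map ¿_ Γ) (π-seed : SeedByTests (A ∷ map ¿_ Γ) ⟪ π ⟫ᵖ) where

    Related : ∣ A ∣ᶠ → Elem ρ (map ¿_ Γ) → Set
    Related a g = T (⟪ π ⟫ᵖ (a , g))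

    Realisable : Factors Γ → List ∣ A ∣ᶠ → Set
    Realisable Z bs = ∃ λ gs → Pointwise Related bs gs × All∏set Γ Z (sumᵉ ρ Γ gs)

    residuals : ∀ as gs → Pointwise Related as gs → ∀ Z → AllPᗮ* Γ Z (sumᵉ ρ Γ gs) →
      ∃ λ us → Pointwise (λ a u → T (P ⟪ A ⟫ u a)) as us × (∀ bs → bs ∈ᴾ us → ¬ ¬ Realisable Z bs)
    residuals [] [] [] Z pZ = [] , [] , λ { [] [] k → k ([] , [] , All∏set-sum[] Γ Z pZ) }
    residuals (a ∷ as) (g ∷ gs) (r ∷ rs) Z pZ
      with AllPᗮ*-add⁻ Γ Z g (sumᵉ ρ Γ gs) (subst (AllPᗮ* Γ Z) (sumᵉ-∷ Γ g gs) pZ)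
    ... | Z₀ , Z₁ , refl , pZ₀ , pZ₁ with residuals as gs rs Z₁ pZ₁
    ... | us , pus , realise = u ∷ us , pu ∷ pus , realise′
      where
      u : Subset ∣ A ∣ᶠ
      u = residual A (map ¿_ Γ) ⟪ π ⟫ᵖ (∁∏sets Γ Z₀)
      pu : T (P ⟪ A ⟫ u a)
      pu = residual-P A (map ¿_ Γ) π-seed (∁∏sets Γ Z₀) r (AllPᗮ*⇒¬Hitᴾ Γ Z₀ g pZ₀)
      realise′ : ∀ bs → bs ∈ᴾ (u ∷ us) → ¬ ¬ Realisable (addᶠ Γ Z₀ Z₁) bs
      realise′ (b ∷ bs) (ub ∷ bs∈) k =
        ω-elim ub λ { (g′ , r′ , ¬hit) → realise bs bs∈ λ { (gs′ , rs′ , gs′∈) →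
          k (g′ ∷ gs′ , r′ ∷ rs′ ,
             subst (All∏set Γ _) (sym (sumᵉ-∷ Γ g′ gs′))
               (All∏set-add Γ (¬Hit⇒All∏set Γ Z₀ g′ ¬hit) gs′∈)) } }

    ∏-realisable : ∀ x t Z us → Covers (! A ∷ map ¿_ Γ) (x , t) ⟪ prom π ⟫ᵖ → All∏⊆∁ Γ t Z →
      (∀ bs → bs ∈ᴾ us → ¬ ¬ Realisable Z bs) → ∏ us x
    ∏-realisable x t Z us cov Z⊆∁t realise l (bs , bs∈ , l↭bs) = T-stable λ ¬xl →
      realise bs bs∈ λ { (gs , rs , gs∈) →
        let (gs′ , rs′ , gs↭gs′) = Pointwise-↭ˡ rs (↭-sym l↭bs) in
        cov (l , sumᵉ ρ Γ gs) (ω-intro (gs′ , rs′ , sumᵉ-↭ Γ gs↭gs′))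
          [ ¬xl , All∏set⇒¬Hit Γ t Z (sumᵉ ρ Γ gs) Z⊆∁t gs∈ ] }

  prom-seed : ∀ {A Γ} (π : ⊢ A ∷ map ¿_ Γ) → SeedByTests (A ∷ map ¿_ Γ) ⟪ π ⟫ᵖ →
    SeedByTests (! A ∷ map ¿_ Γ) ⟪ prom π ⟫ᵖ
  prom-seed {A} {Γ} π π-seed (as , γ) h (x , t) cov ¬hit =
    ω-elim h λ { (gs , rs , γ≈Σgs) → AllPᗮ*-of-¬Hitᴾ Γ t γ (¬hit ∘ inj₂) λ { (Z , Z⊆∁t , pZ) →
      let (Z′ , Z′⊆∁t , pZ′) = AllPᗮ*-resp-PermEq Γ t Z γ (sumᵉ ρ Γ gs) γ≈Σgs Z⊆∁t pZ
          (us , pus , realise) = residuals as gs rs Z′ pZ′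
      in ¬hit (inj₁ (ω-intro (us , ∏-realisable x t Z′ us cov Z′⊆∁t realise , pus))) } }
    where open Promotion π π-seed

  seed : ∀ {Γ} (π : ⊢ Γ) → SeedByTests Γ ⟪ π ⟫ᵖ
  seed (ax {A}) = ax-seed A
  seed (cut π₁ π₂) = cut-seed π₁ π₂ (seed π₁) (seed π₂)
  seed (ex p π) = ex-seed p π (seed π)
  seed one = one-seed
  seed (bot π) = bot-seed π (seed π)
  seed top = top-seed
  seed (tens π₁ π₂) = tens-seed π₁ π₂ (seed π₁) (seed π₂)
  seed (par π) = par-seed π (seed π)
  seed (plus₁ π) = plus₁-seed π (seed π)
  seed (plus₂ π) = plus₂-seed π (seed π)
  seed (with' π₁ π₂) = with-seed π₁ π₂ (seed π₁) (seed π₂)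
  seed (der π) = der-seed π (seed π)
  seed (weak π) = weak-seed π (seed π)
  seed (contr π) = contr-seed π (seed π)
  seed (prom π) = prom-seed π (seed π)

proposition4 : (C : Classical) (ρ : ℕ → Interface) →
               (∀ n → Monotone (ρ n)) →
               {Γ : List Formula} (π : ⊢ Γ) →
               Seed (Sem.⟦_⟧ˢ C ρ Γ) (Sem.⟦_⟧ᵖ C ρ π)
proposition4 C ρ ρ-monotone {Γ} π = seed-by-tests Γ (Sem.⟦_⟧ᵖ C ρ π) (seed π)
  where open Soundness C ρ ρ-monotone
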